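{- Let $A$ be a nondeterministic Büchi automaton over $2^{I\cup O}$ in which every state and transition lies on an accepting run, let $X \subseteq O$ be automata dependent on $I \cup (O \setminus X)$ in $A$, and let $B_{(s,s')}$ be the Boolean function over $I \cup O$ labelling a transition $(s,s')$ of $A$. For every $(\sigma_I,\sigma) \in \Sigma_I \times \Sigma_{O\setminus X}$, if $(\sigma_I,\sigma) \models \exists X\, B_{(s,s')}$, then there is a unique $\sigma' \in \Sigma_X$ such that $(\sigma_I,\sigma,\sigma') \models B_{(s,s')}$.
   Context: $\Sigma_Z = 2^Z$ is the set of assignments to $Z$. The label $B_{(s,s')}$ of an edge is a Boolean function whose satisfying assignments are exactly the letters $a$ with $s' \in \delta(s,a)$. A pair $(s,s')$ of states is compatible if some finite word has runs from the initial state to $s$ and to $s'$. For letters $a$ and $Z \subseteq I\cup O$, $a.Z$ is the restriction of $a$ to $Z$. $X$ is automata dependent on $Y$ in $A$ if for every compatible pair $(s,s')$ and letters $a,a'$ with $a.Y = a'.Y$, $a.X \ne a'.X$, not both $\delta(s,a) \ne\emptyset$ and $\delta(s',a') \ne \emptyset$. -}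

module Defs where

open import Data.Nat using (ℕ; zero; suc; _≤_; _<_)
open import Data.Bool using (Bool)
open import Data.Fin using (Fin)
open import Data.Fin.Subset using (Subset; _∈_; _∉_; _∪_; _─_; _⊆_; Nonempty)
open import Data.Product using (Σ; ∃; _×_)
open import Relation.Binary.PropositionalEquality using (_≡_)
open import Relation.Nullary using (¬_)

-- Propositional variables are Fin n.  A letter of the alphabet 2^{I ∪ O}
-- is an assignment of truth values to the variables (I ∪ O will be
-- required to cover all of Fin n, see `VarPartition`).
Letter : ℕ → Set
Letter n = Fin n → Bool

Asg : ∀ {n} → Subset n → Set
Asg {n} Z = (v : Fin n) → v ∈ Z → Bool

_≈[_]_ : ∀ {n} → Letter n → Subset n → Letter n → Set
a ≈[ Z ] a' = ∀ v → v ∈ Z → a v ≡ a' v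

_≈ₐ_ : ∀ {n} {Z : Subset n} → Asg Z → Asg Z → Set
_≈ₐ_ {n} {Z} σ σ' = ∀ v (p : v ∈ Z) → σ v p ≡ σ' v p

Extends : ∀ {n} {Z : Subset n} → Letter n → Asg Z → Set
Extends {n} {Z} a σ = ∀ v (p : v ∈ Z) → a v ≡ σ v p

record VarPartition (n : ℕ) (I O : Subset n) : Set where
  field
    disjoint : ∀ v → v ∈ I → v ∉ O
    cover    : ∀ v → v ∈ I ∪ O

record NBA (n : ℕ) : Set where
  field
    states : ℕ
    init   : Fin states
    δ      : Fin states → Letter n → Subset states
    acc    : Subset states

module _ {n : ℕ} (A : NBA n) where
  open NBA A

  IsRun : (ℕ → Letter n) → (ℕ → Fin states) → Set
  IsRun w r = (r 0 ≡ init) × (∀ k → r (suc k) ∈ δ (r k) (w k))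

  IsAcceptingRun : (ℕ → Letter n) → (ℕ → Fin states) → Set
  IsAcceptingRun w r = IsRun w r × (∀ k → ∃ λ j → k ≤ j × r j ∈ acc)

  StateOnAccRun : Fin states → Set
  StateOnAccRun s = ∃ λ w → ∃ λ r → IsAcceptingRun w r × ∃ λ k → r k ≡ s

  IsTransition : Fin states → Fin states → Set
  IsTransition s s' = ∃ λ a → s' ∈ δ s a

  TransOnAccRun : Fin states → Fin states → Set
  TransOnAccRun s s' =
    ∃ λ w → ∃ λ r → IsAcceptingRun w r × ∃ λ k → (r k ≡ s) × (r (suc k) ≡ s')

  AllOnAccRuns : Set
  AllOnAccRuns = (∀ s → StateOnAccRun s)
               × (∀ s s' → IsTransition s s' → TransOnAccRun s s')

  FinRunTo : (ℓ : ℕ) → (ℕ → Letter n) → Fin states → Set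
  FinRunTo ℓ u s = ∃ λ (r : ℕ → Fin states) →
    (r 0 ≡ init) × (r ℓ ≡ s) × (∀ k → k < ℓ → r (suc k) ∈ δ (r k) (u k))

  Compatible : Fin states → Fin states → Set
  Compatible s s' = ∃ λ ℓ → ∃ λ u → FinRunTo ℓ u s × FinRunTo ℓ u s'

  AutomataDependent : Subset n → Subset n → Set
  AutomataDependent X Y = ∀ s s' → Compatible s s' → ∀ (a a' : Letter n) →
    a ≈[ Y ] a' → ¬ (a ≈[ X ] a') → ¬ (Nonempty (δ s a) × Nonempty (δ s' a'))

  -- a ⊨ B_(s,s')  :⇔  s' ∈ δ(s,a)
  SatB : Fin states → Fin states → Letter n → Set
  SatB s s' a = s' ∈ δ s a

  Sat3 : (I O X : Subset n) → Fin states → Fin states →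
         Asg I → Asg (O ─ X) → Asg X → Set
  Sat3 I O X s s' σI σ σ' =
    ∃ λ a → Extends a σI × Extends a σ × Extends a σ' × SatB s s' a

  SatEx : (I O X : Subset n) → Fin states → Fin states →
          Asg I → Asg (O ─ X) → Set
  SatEx I O X s s' σI σ = ∃ λ (σ' : Asg X) → Sat3 I O X s s' σI σ σ'

{-# OPTIONS --safe #-}
-- Two letters witnessing (σI , σ , σ') ⊨ B_(s,s') and (σI , σ , σ'') ⊨ B_(s,s')
-- agree on I ∪ (O ∖ X) and are both enabled in s.  Since s lies on a run, (s , s)
-- is compatible, so automata dependence of X forces the letters to agree on X as
-- well, i.e. σ' and σ'' coincide.
module Submission where

open import Defs
open import Data.Nat using (ℕ)
open import Data.Fin using (Fin)
open import Data.Fin.Subset using (Subset; _∪_; _─_; _⊆_; Nonempty)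
open import Data.Fin.Subset.Properties using (x∈p∪q⁻)
open import Data.Product using (Σ; _×_; _,_)
open import Data.Sum using (inj₁; inj₂)
open import Data.Bool.Properties using (_≟_)
open import Relation.Nullary.Decidable using (decidable-stable)
open import Relation.Binary.PropositionalEquality using (refl; sym; trans)

module _ {n : ℕ} where

  extends⇒≈ : ∀ {Z : Subset n} {σ : Asg Z} {a a' : Letter n} →
              Extends a σ → Extends a' σ → a ≈[ Z ] a'
  extends⇒≈ aσ a'σ v v∈Z = trans (aσ v v∈Z) (sym (a'σ v v∈Z))

  ≈-∪ : ∀ {Y Z : Subset n} {a a' : Letter n} →
        a ≈[ Y ] a' → a ≈[ Z ] a' → a ≈[ Y ∪ Z ] a'
  ≈-∪ {Y} {Z} a≈Y a≈Z v v∈Y∪Z with x∈p∪q⁻ Y Z v∈Y∪Z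
  ... | inj₁ v∈Y = a≈Y v v∈Y
  ... | inj₂ v∈Z = a≈Z v v∈Z

  extends-≈⇒≈ₐ : ∀ {Z : Subset n} {σ σ' : Asg Z} {a a' : Letter n} →
                 Extends a σ → Extends a' σ' → a ≈[ Z ] a' → σ ≈ₐ σ'
  extends-≈⇒≈ₐ aσ a'σ' a≈a' v v∈Z =
    trans (sym (aσ v v∈Z)) (trans (a≈a' v v∈Z) (a'σ' v v∈Z))

module _ {n : ℕ} (A : NBA n) where
  open NBA A

  run⇒finRunTo : ∀ {w r} → IsRun A w r → ∀ k → FinRunTo A k w (r k)
  run⇒finRunTo {r = r} (r0 , step) k = r , r0 , refl , λ j _ → step j

  stateOnAccRun⇒compatible : ∀ {s} → StateOnAccRun A s → Compatible A s s
  stateOnAccRun⇒compatible (w , r , (run , _) , k , refl) =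
    k , w , run⇒finRunTo run k , run⇒finRunTo run k

  dependent⇒agree : ∀ {X Y s s' a a'} → AutomataDependent A X Y →
                    Compatible A s s' → Nonempty (δ s a) → Nonempty (δ s' a') →
                    a ≈[ Y ] a' → a ≈[ X ] a'
  dependent⇒agree {a = a} {a'} dep comp enabled enabled' a≈a' v v∈X =
    decidable-stable (a v ≟ a' v) λ av≢a'v →
      dep _ _ comp a a' a≈a' (λ a≈Xa' → av≢a'v (a≈Xa' v v∈X)) (enabled , enabled')

  sat3-unique : ∀ (I O X : Subset n) {s s' σI σ σ' σ''} →
                AutomataDependent A X (I ∪ (O ─ X)) → Compatible A s s →
                Sat3 A I O X s s' σI σ σ' → Sat3 A I O X s s' σI σ σ'' → σ' ≈ₐ σ''
  sat3-unique I O X dep comp (a , aI , aO , aX , sat) (a' , a'I , a'O , a'X , sat') =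
    extends-≈⇒≈ₐ aX a'X
      (dependent⇒agree dep comp (_ , sat) (_ , sat')
        (≈-∪ (extends⇒≈ aI a'I) (extends⇒≈ aO a'O)))

proposition2 : ∀ {n : ℕ} (I O X : Subset n) → VarPartition n I O → X ⊆ O →
    (A : NBA n) → AllOnAccRuns A → AutomataDependent A X (I ∪ (O ─ X)) →
    ∀ (s s' : Fin (NBA.states A)) (σI : Asg I) (σ : Asg (O ─ X)) →
    SatEx A I O X s s' σI σ →
    Σ (Asg X) (λ σ' → Sat3 A I O X s s' σI σ σ'
      × (∀ (σ'' : Asg X) → Sat3 A I O X s s' σI σ σ'' → σ' ≈ₐ σ''))
proposition2 I O X _ _ A (statesOnAccRuns , _) dep s s' σI σ (σ' , sat) =
  σ' , sat , λ σ'' sat'' → sat3-unique A I O X dep compatible-s-s sat sat''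
  where
  compatible-s-s : Compatible A s s
  compatible-s-s = stateOnAccRun⇒compatible A (statesOnAccRuns s)
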